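{- Let $G$ be a finite simple graph and let $I_c$ be a maximum critical independent set of $G$. Then $\alpha(G)=\alpha'(G)$ if and only if $I_c\cup N(I_c)=V(G)$.
   Context: For $S\subseteq V(G)$, $N(S)=\bigcup_{u\in S}N(u)$. $\alpha(G)$ is the independence number. An independent set $I_c$ is a critical independent set if $|I_c|-|N(I_c)|\ge |J|-|N(J)|$ for every independent set $J$ of $G$; a maximum critical independent set is one of maximum cardinality, and $\alpha'(G)$ denotes that cardinality. -}

module Defs where

open import Data.Nat using (ℕ; zero; suc; _≤_)
open import Data.Bool using (Bool; true; false; _∧_; _∨_)
open import Data.Fin using (Fin; zero; suc)
open import Data.Fin.Subset using (Subset; _∈_; ∣_∣)
open import Data.Vec using (lookup; tabulate)
open import Data.Integer using (ℤ; +_; _-_) renaming (_≤_ to _≤ℤ_)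
open import Data.Product using (Σ; _×_)
open import Relation.Binary.PropositionalEquality using (_≡_)

record Graph (n : ℕ) : Set where
  field
    adj    : Fin n → Fin n → Bool
    sym    : ∀ u v → adj u v ≡ adj v u
    irrefl : ∀ v → adj v v ≡ false
open Graph public

anyFin : ∀ {n} → (Fin n → Bool) → Bool
anyFin {zero}  p = false
anyFin {suc n} p = p zero ∨ anyFin (λ i → p (suc i))

N : ∀ {n} → Graph n → Subset n → Subset n
N G S = tabulate (λ v → anyFin (λ u → lookup S u ∧ adj G u v))

Independent : ∀ {n} → Graph n → Subset n → Set
Independent G S = ∀ u v → u ∈ S → v ∈ S → adj G u v ≡ false

excess : ∀ {n} → Graph n → Subset n → ℤ
excess G S = + ∣ S ∣ - + ∣ N G S ∣

Critical : ∀ {n} → Graph n → Subset n → Set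
Critical G I = Independent G I ×
  (∀ J → Independent G J → excess G J ≤ℤ excess G I)

MaximumCritical : ∀ {n} → Graph n → Subset n → Set
MaximumCritical G I = Critical G I × (∀ J → Critical G J → ∣ J ∣ ≤ ∣ I ∣)

IsMaxSize : ∀ {n} → (Subset n → Set) → ℕ → Set
IsMaxSize P k = Σ _ (λ S → P S × ∣ S ∣ ≡ k) × (∀ S → P S → ∣ S ∣ ≤ k)

IsIndependenceNumber : ∀ {n} → Graph n → ℕ → Set
IsIndependenceNumber G = IsMaxSize (Independent G)

IsCriticalIndependenceNumber : ∀ {n} → Graph n → ℕ → Set
IsCriticalIndependenceNumber G = IsMaxSize (Critical G)

module Submission where

-- (⇒) A maximum independent set I dominates the graph: a vertex x outside
--     I ∪ N(I) could be added to I, keeping it independent.  If α = α', then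
--     ∣ Ic ∣ = α, so Ic is a maximum independent set and Ic ∪ N(Ic) = V.
-- (⇐) For any critical independent I and independent J we show
--     ∣ J ∩ I ∣ + ∣ J ∩ N(I) ∣ ≤ ∣ I ∣: with K = J ∩ N(I) and B = I ∖ N(K),
--     J ∩ I ⊆ B, while N(B) and K are disjoint subsets of N(I); criticality of
--     I against B gives ∣ B ∣ + ∣ N(I) ∣ ≤ ∣ I ∣ + ∣ N(B) ∣, whence
--     ∣ B ∣ + ∣ K ∣ ≤ ∣ I ∣.  If I ∪ N(I) = V then J is covered by J ∩ I and
--     J ∩ N(I), so ∣ J ∣ ≤ ∣ I ∣ and Ic is a maximum independent set: α = α'.

open import Defs hiding (sym)
open import Data.Nat using (ℕ)
open import Data.Fin.Subset using (Subset; _∪_; ⊤)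
open import Data.Product using (_×_)
open import Relation.Binary.PropositionalEquality using (_≡_)

open import Data.Nat using (zero; suc; _+_; _≤_)
open import Data.Nat.Properties as ℕ
  using (+-suc; +-comm; +-assoc; +-cancelʳ-≤; +-monoˡ-≤; +-monoʳ-≤; ≤-antisym; ≤-trans; ≤-reflexive; m≤m+n)
open import Data.Bool using (Bool; true; false; _∧_)
open import Data.Fin using (Fin; zero; suc)
open import Data.Fin.Subset using (_∈_; _∉_; _⊆_; _⊂_; ∣_∣; _∩_; ∁; ⁅_⁆; inside; outside; Empty)
open import Data.Fin.Subset.Properties
  using ( p⊆p∪q; q⊆p∪q; x∈p∪q⁻; p∩q⊆p; p∩q⊆q; x∈p∩q⁺; x∈p∩q⁻; x∈⁅y⁆⇒x≡y; x∈⁅x⁆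
        ; x∉p⇒x∈∁p; x∈∁p⇒x∉p; ⊆⊤; ⊆-antisym; p⊆q⇒∣p∣≤∣q∣; p⊂q⇒∣p∣<∣q∣
        ; Empty-unique; ∣⊥∣≡0; _∈?_; ∩-identityʳ; ∩-distribˡ-∪ )
open import Data.Vec using ([]; _∷_)
open import Data.Vec.Properties using (lookup∘tabulate; []=⇒lookup; lookup⇒[]=)
open import Data.Product using (_,_; proj₁; proj₂; ∃)
open import Data.Sum using (inj₁; inj₂)
open import Data.Empty using (⊥-elim)
open import Relation.Nullary using (yes; no)
open import Relation.Binary.PropositionalEquality using (refl; sym; trans; cong; subst)
open import Data.Integer using (ℤ; +_; _-_)
import Data.Integer as ℤ
import Data.Integer.Properties as ℤ
open import Data.Integer.Tactic.RingSolver using (solve-∀)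

∣p∪q∣+∣p∩q∣≡∣p∣+∣q∣ : ∀ {n} (p q : Subset n) → ∣ p ∪ q ∣ + ∣ p ∩ q ∣ ≡ ∣ p ∣ + ∣ q ∣
∣p∪q∣+∣p∩q∣≡∣p∣+∣q∣ []            []            = refl
∣p∪q∣+∣p∩q∣≡∣p∣+∣q∣ (inside ∷ p)  (inside ∷ q)  =
  cong suc (trans (+-suc ∣ p ∪ q ∣ ∣ p ∩ q ∣)
                  (trans (cong suc (∣p∪q∣+∣p∩q∣≡∣p∣+∣q∣ p q)) (sym (+-suc ∣ p ∣ ∣ q ∣))))
∣p∪q∣+∣p∩q∣≡∣p∣+∣q∣ (inside ∷ p)  (outside ∷ q) = cong suc (∣p∪q∣+∣p∩q∣≡∣p∣+∣q∣ p q)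
∣p∪q∣+∣p∩q∣≡∣p∣+∣q∣ (outside ∷ p) (inside ∷ q)  =
  trans (cong suc (∣p∪q∣+∣p∩q∣≡∣p∣+∣q∣ p q)) (sym (+-suc ∣ p ∣ ∣ q ∣))
∣p∪q∣+∣p∩q∣≡∣p∣+∣q∣ (outside ∷ p) (outside ∷ q) = ∣p∪q∣+∣p∩q∣≡∣p∣+∣q∣ p q

∣p∪q∣≤∣p∣+∣q∣ : ∀ {n} (p q : Subset n) → ∣ p ∪ q ∣ ≤ ∣ p ∣ + ∣ q ∣
∣p∪q∣≤∣p∣+∣q∣ p q = ≤-trans (m≤m+n ∣ p ∪ q ∣ ∣ p ∩ q ∣) (≤-reflexive (∣p∪q∣+∣p∩q∣≡∣p∣+∣q∣ p q))

disjoint-⊆⇒∣p∣+∣q∣≤ : ∀ {n} {p q r : Subset n} →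
  Empty (p ∩ q) → p ⊆ r → q ⊆ r → ∣ p ∣ + ∣ q ∣ ≤ ∣ r ∣
disjoint-⊆⇒∣p∣+∣q∣≤ {n} {p} {q} {r} disjoint p⊆r q⊆r = begin
  ∣ p ∣ + ∣ q ∣             ≡⟨ ∣p∪q∣+∣p∩q∣≡∣p∣+∣q∣ p q ⟨
  ∣ p ∪ q ∣ + ∣ p ∩ q ∣     ≡⟨ cong (λ m → ∣ p ∪ q ∣ + m) (trans (cong ∣_∣ (Empty-unique disjoint)) (∣⊥∣≡0 n)) ⟩
  ∣ p ∪ q ∣ + 0             ≡⟨ +-comm ∣ p ∪ q ∣ 0 ⟩
  ∣ p ∪ q ∣                 ≤⟨ p⊆q⇒∣p∣≤∣q∣ p∪q⊆r ⟩
  ∣ r ∣                     ∎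
  where
  open ℕ.≤-Reasoning
  p∪q⊆r : p ∪ q ⊆ r
  p∪q⊆r {x} x∈p∪q with x∈p∪q⁻ p q x∈p∪q
  ... | inj₁ x∈p = p⊆r x∈p
  ... | inj₂ x∈q = q⊆r x∈q

all∈⇒≡⊤ : ∀ {n} (p : Subset n) → (∀ x → x ∈ p) → p ≡ ⊤
all∈⇒≡⊤ p all∈ = ⊆-antisym ⊆⊤ (λ {x} _ → all∈ x)

excess-≤⇒ : ∀ a b c d → + a - + b ℤ.≤ + c - + d → a + d ≤ c + b
excess-≤⇒ a b c d a-b≤c-d = ℤ.drop‿+≤+ (begin
  + a ℤ.+ + d                         ≡⟨ shift (+ a) (+ b) (+ d) ⟩
  (+ a - + b) ℤ.+ (+ b ℤ.+ + d)       ≤⟨ ℤ.+-monoˡ-≤ (+ b ℤ.+ + d) a-b≤c-d ⟩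
  (+ c - + d) ℤ.+ (+ b ℤ.+ + d)       ≡⟨ unshift (+ c) (+ d) (+ b) ⟩
  + c ℤ.+ + b                         ∎)
  where
  open ℤ.≤-Reasoning
  shift : ∀ (x y z : ℤ) → x ℤ.+ z ≡ (x - y) ℤ.+ (y ℤ.+ z)
  shift = solve-∀
  unshift : ∀ (x y z : ℤ) → (x - y) ℤ.+ (z ℤ.+ y) ≡ x ℤ.+ z
  unshift = solve-∀

cross-≤ : ∀ {b k i ni nb} → b + ni ≤ i + nb → nb + k ≤ ni → b + k ≤ i
cross-≤ {b} {k} {i} {ni} {nb} crit split = +-cancelʳ-≤ nb (b + k) i (begin
  b + k + nb      ≡⟨ +-assoc b k nb ⟩
  b + (k + nb)    ≡⟨ cong (λ m → b + m) (+-comm k nb) ⟩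
  b + (nb + k)    ≤⟨ +-monoʳ-≤ b split ⟩
  b + ni          ≤⟨ crit ⟩
  i + nb          ∎)
  where open ℕ.≤-Reasoning

anyFin⁻ : ∀ {n} (p : Fin n → Bool) → anyFin p ≡ true → ∃ λ i → p i ≡ true
anyFin⁻ {zero}  p ()
anyFin⁻ {suc n} p any with p zero in p0
... | true  = zero , p0
... | false with anyFin⁻ (λ i → p (suc i)) any
...   | i , pi = suc i , pi

anyFin⁺ : ∀ {n} (p : Fin n → Bool) i → p i ≡ true → anyFin p ≡ true
anyFin⁺ {suc n} p zero    pi rewrite pi = refl
anyFin⁺ {suc n} p (suc i) pi with p zero
... | true  = refl
... | false = anyFin⁺ (λ j → p (suc j)) i pi

∧-true⁻ : ∀ {x y} → x ∧ y ≡ true → x ≡ true × y ≡ true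
∧-true⁻ {true} {true} _ = refl , refl

∈N⁻ : ∀ {n} (G : Graph n) (S : Subset n) v → v ∈ N G S → ∃ λ u → u ∈ S × adj G u v ≡ true
∈N⁻ G S v v∈NS with anyFin⁻ _ (trans (sym (lookup∘tabulate _ v)) ([]=⇒lookup v∈NS))
... | u , Su∧uv = u , lookup⇒[]= u S (proj₁ (∧-true⁻ Su∧uv)) , proj₂ (∧-true⁻ Su∧uv)

∈N⁺ : ∀ {n} (G : Graph n) (S : Subset n) {u v} → u ∈ S → adj G u v ≡ true → v ∈ N G S
∈N⁺ G S {u} {v} u∈S uv = lookup⇒[]= v (N G S) (trans (lookup∘tabulate _ v)
  (anyFin⁺ _ u (subst (λ b → b ∧ adj G u v ≡ true) (sym ([]=⇒lookup u∈S)) uv)))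

N-mono : ∀ {n} (G : Graph n) {S T : Subset n} → S ⊆ T → N G S ⊆ N G T
N-mono G {S} {T} S⊆T {v} v∈NS with ∈N⁻ G S v v∈NS
... | u , u∈S , uv = ∈N⁺ G T (S⊆T u∈S) uv

∉N⇒non-adjacent : ∀ {n} (G : Graph n) (S : Subset n) {u v} → v ∉ N G S → u ∈ S → adj G u v ≡ false
∉N⇒non-adjacent G S {u} {v} v∉NS u∈S with adj G u v in uv
... | true  = ⊥-elim (v∉NS (∈N⁺ G S u∈S uv))
... | false = refl

independent⇒∉N : ∀ {n} (G : Graph n) {J S : Subset n} → Independent G J → S ⊆ J →
  ∀ {x} → x ∈ J → x ∉ N G S
independent⇒∉N G {J} {S} indJ S⊆J x∈J x∈NS with ∈N⁻ G S _ x∈NS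
... | u , u∈S , ux with trans (sym ux) (indJ u _ (S⊆J u∈S) x∈J)
...   | ()

independent-extend : ∀ {n} (G : Graph n) {I : Subset n} {x} →
  Independent G I → x ∉ N G I → Independent G (I ∪ ⁅ x ⁆)
independent-extend G {I} {x} indI x∉NI u v u∈ v∈ with x∈p∪q⁻ I ⁅ x ⁆ u∈ | x∈p∪q⁻ I ⁅ x ⁆ v∈
... | inj₁ u∈I | inj₁ v∈I = indI u v u∈I v∈I
... | inj₁ u∈I | inj₂ v∈x rewrite x∈⁅y⁆⇒x≡y x v∈x = ∉N⇒non-adjacent G I x∉NI u∈I
... | inj₂ u∈x | inj₁ v∈I rewrite x∈⁅y⁆⇒x≡y x u∈x = trans (Graph.sym G x v) (∉N⇒non-adjacent G I x∉NI v∈I)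
... | inj₂ u∈x | inj₂ v∈x rewrite x∈⁅y⁆⇒x≡y x u∈x | x∈⁅y⁆⇒x≡y x v∈x = irrefl G x

maximum-independent-dominates : ∀ {n} (G : Graph n) (I : Subset n) →
  Independent G I → (∀ J → Independent G J → ∣ J ∣ ≤ ∣ I ∣) → I ∪ N G I ≡ ⊤
maximum-independent-dominates G I indI maximum = all∈⇒≡⊤ _ covered
  where
  covered : ∀ x → x ∈ I ∪ N G I
  covered x with x ∈? (I ∪ N G I)
  ... | yes x∈ = x∈
  ... | no  x∉ = ⊥-elim (ℕ.<⇒≱ (p⊂q⇒∣p∣<∣q∣ I⊂I∪x) (maximum (I ∪ ⁅ x ⁆) (independent-extend G indI x∉NI)))
    where
    x∉NI : x ∉ N G I
    x∉NI x∈NI = x∉ (q⊆p∪q I (N G I) x∈NI)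
    I⊂I∪x : I ⊂ I ∪ ⁅ x ⁆
    I⊂I∪x = p⊆p∪q ⁅ x ⁆ , x , q⊆p∪q I ⁅ x ⁆ (x∈⁅x⁆ x) , λ x∈I → x∉ (p⊆p∪q (N G I) x∈I)

-- Compare I with its
-- independent subset B = I ∖ N(K), where K = J ∩ N(I).
critical-bound : ∀ {n} (G : Graph n) {I : Subset n} → Critical G I →
  ∀ J → Independent G J → ∣ J ∩ I ∣ + ∣ J ∩ N G I ∣ ≤ ∣ I ∣
critical-bound G {I} (indI , critI) J indJ =
  ≤-trans (+-monoˡ-≤ ∣ K ∣ (p⊆q⇒∣p∣≤∣q∣ J∩I⊆B)) ∣B∣+∣K∣≤∣I∣
  where
  K B : Subset _
  K = J ∩ N G I
  B = I ∩ ∁ (N G K)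

  -- J is independent and K ⊆ J, so J avoids N(K).
  J∩I⊆B : J ∩ I ⊆ B
  J∩I⊆B {x} x∈J∩I with x∈p∩q⁻ J I x∈J∩I
  ... | x∈J , x∈I = x∈p∩q⁺ (x∈I , x∉p⇒x∈∁p (independent⇒∉N G indJ (p∩q⊆p J (N G I)) x∈J))

  indB : Independent G B
  indB u v u∈B v∈B = indI u v (p∩q⊆p I _ u∈B) (p∩q⊆p I _ v∈B)

  -- A common element of N(B) and K would put a vertex of B into N(K).
  NB∩K-empty : Empty (N G B ∩ K)
  NB∩K-empty (v , v∈NB∩K) with x∈p∩q⁻ (N G B) K v∈NB∩K
  ... | v∈NB , v∈K with ∈N⁻ G B v v∈NB
  ...   | u , u∈B , uv = x∈∁p⇒x∉p (p∩q⊆q I _ u∈B) (∈N⁺ G K v∈K (trans (Graph.sym G v u) uv))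

  ∣NB∣+∣K∣≤∣NI∣ : ∣ N G B ∣ + ∣ K ∣ ≤ ∣ N G I ∣
  ∣NB∣+∣K∣≤∣NI∣ = disjoint-⊆⇒∣p∣+∣q∣≤ NB∩K-empty (N-mono G (p∩q⊆p I _)) (p∩q⊆q J (N G I))

  ∣B∣+∣K∣≤∣I∣ : ∣ B ∣ + ∣ K ∣ ≤ ∣ I ∣
  ∣B∣+∣K∣≤∣I∣ = cross-≤ (excess-≤⇒ (∣ B ∣) (∣ N G B ∣) (∣ I ∣) (∣ N G I ∣) (critI B indB)) ∣NB∣+∣K∣≤∣NI∣

critical-dominating-is-maximum : ∀ {n} (G : Graph n) {I : Subset n} → Critical G I →
  I ∪ N G I ≡ ⊤ → ∀ J → Independent G J → ∣ J ∣ ≤ ∣ I ∣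
critical-dominating-is-maximum G {I} critI dominating J indJ = begin
  ∣ J ∣                           ≡⟨ cong ∣_∣ (∩-identityʳ J) ⟨
  ∣ J ∩ ⊤ ∣                       ≡⟨ cong (λ T → ∣ J ∩ T ∣) dominating ⟨
  ∣ J ∩ (I ∪ N G I) ∣             ≡⟨ cong ∣_∣ (∩-distribˡ-∪ J I (N G I)) ⟩
  ∣ (J ∩ I) ∪ (J ∩ N G I) ∣       ≤⟨ ∣p∪q∣≤∣p∣+∣q∣ (J ∩ I) (J ∩ N G I) ⟩
  ∣ J ∩ I ∣ + ∣ J ∩ N G I ∣       ≤⟨ critical-bound G critI J indJ ⟩
  ∣ I ∣                           ∎
  where open ℕ.≤-Reasoning

lemma2p1 : ∀ {n} (G : Graph n) (Ic : Subset n) (a a' : ℕ) →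
    MaximumCritical G Ic →
    IsIndependenceNumber G a →
    IsCriticalIndependenceNumber G a' →
    (a ≡ a' → Ic ∪ N G Ic ≡ ⊤) × (Ic ∪ N G Ic ≡ ⊤ → a ≡ a')
lemma2p1 G Ic a a' (critIc , maxCritIc) ((S , indS , ∣S∣≡a) , α-bound) ((S' , critS' , ∣S'∣≡a') , α'-bound) =
  α≡α'⇒dominating , dominating⇒α≡α'
  where
  a'≤∣Ic∣ : a' ≤ ∣ Ic ∣
  a'≤∣Ic∣ = subst (_≤ ∣ Ic ∣) ∣S'∣≡a' (maxCritIc S' critS')

  α≡α'⇒dominating : a ≡ a' → Ic ∪ N G Ic ≡ ⊤
  α≡α'⇒dominating a≡a' = maximum-independent-dominates G Ic (proj₁ critIc)
    (λ J indJ → ≤-trans (α-bound J indJ) (subst (_≤ ∣ Ic ∣) (sym a≡a') a'≤∣Ic∣))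

  dominating⇒α≡α' : Ic ∪ N G Ic ≡ ⊤ → a ≡ a'
  dominating⇒α≡α' dominating = ≤-antisym
    (≤-trans (subst (_≤ ∣ Ic ∣) ∣S∣≡a (critical-dominating-is-maximum G critIc dominating S indS))
             (α'-bound Ic critIc))
    (subst (_≤ a) ∣S'∣≡a' (α-bound S' (proj₁ critS')))
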